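{- Let $G_1$ and $G_2$ be finite simple graphs, where $G_i$ has $n_i$ vertices, $m_i$ edges, minimum degree $\delta_{G_i}$ and maximum degree $\Delta_{G_i}$ ($i=1,2$). Then $\alpha_1 \leq ESO(G_1\circ G_2)\leq \alpha_2$, where $$\alpha_1=2\sqrt{2}\,m_1(\delta_{G_1}+n_2)^2+2\sqrt{2}\,n_1m_2(\delta_{G_2}+1)^2+n_1n_2(\delta_{G_1}+n_2+\delta_{G_2}+1)\{(\delta_{G_1}+n_2)^2+(\delta_{G_2}+1)^2\}^{\frac{1}{2}},$$ $$\alpha_2=2\sqrt{2}\,m_1(\Delta_{G_1}+n_2)^2+2\sqrt{2}\,n_1m_2(\Delta_{G_2}+1)^2+n_1n_2(\Delta_{G_1}+n_2+\Delta_{G_2}+1)\{(\Delta_{G_1}+n_2)^2+(\Delta_{G_2}+1)^2\}^{\frac{1}{2}}.$$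
   Context: For a graph $G$ and vertex $u$, $d(u)$ denotes the degree of $u$ in $G$. The elliptic Sombor index of a graph $G$ is $ESO(G)=\sum_{uv\in E(G)}(d(u)+d(v))\sqrt{d(u)^2+d(v)^2}$. The corona product $G_1\circ G_2$, where $G_1$ has vertices $u_1,\dots,u_{n_1}$, is the graph obtained by taking $G_1$ together with $n_1$ vertex-disjoint copies of $G_2$ and joining the vertex $u_i$ of $G_1$ by an edge to every vertex of the $i$-th copy of $G_2$, for $i=1,\dots,n_1$. -}

module Defs where

open import Level using (Level; _⊔_) renaming (suc to lsuc)
open import Data.Nat as ℕ using (ℕ; zero; suc; _⊓_)
open import Data.Bool using (Bool; true; false; if_then_else_; _∧_)
open import Data.Fin as Fin using (Fin; toℕ; splitAt; remQuot)
open import Data.Fin.Properties using () renaming (_≟_ to _≟ᶠ_)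
open import Data.Sum using (inj₁; inj₂)
open import Data.Product using (_,_; proj₁; proj₂)
import Data.Product
open import Data.List using (List; map; foldr; allFin)
open import Relation.Nullary.Decidable using (⌊_⌋)
open import Relation.Nullary using (¬_)
open import Relation.Binary.PropositionalEquality using (_≡_)
open import Relation.Binary.Core using (Rel)
open import Relation.Binary.Structures using (IsTotalOrder)
open import Algebra.Bundles using (CommutativeRing)

record Graph (n : ℕ) : Set where
  field
    Adj     : Fin n → Fin n → Bool
    symm    : ∀ i j → Adj i j ≡ Adj j i
    irrefl  : ∀ i → Adj i i ≡ false
open Graph public

sumFinℕ : ∀ {n} → (Fin n → ℕ) → ℕ
sumFinℕ {n} f = foldr ℕ._+_ 0 (map f (allFin n))

b2n : Bool → ℕ
b2n true  = 1
b2n false = 0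

degA : ∀ {n} → (Fin n → Fin n → Bool) → Fin n → ℕ
degA A u = sumFinℕ (λ v → b2n (A u v))

deg : ∀ {n} → Graph n → Fin n → ℕ
deg G = degA (Adj G)

edgeCount : ∀ {n} → Graph n → ℕ
edgeCount G = sumFinℕ (λ u → sumFinℕ (λ v →
  b2n (Adj G u v ∧ (toℕ u ℕ.<ᵇ toℕ v))))

-- minimum degree: minimum of the degrees (the initial value n is an
-- upper bound for every degree, so it does not affect the minimum when
-- n ≥ 1; for the empty graph the value is 0)
minDeg : ∀ {n} → Graph n → ℕ
minDeg {n} G = foldr _⊓_ n (map (deg G) (allFin n))

maxDeg : ∀ {n} → Graph n → ℕ
maxDeg {n} G = foldr ℕ._⊔_ 0 (map (deg G) (allFin n))

-- Corona product G₁ ∘ G₂ on Fin (n₁ + n₁ * n₂):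
-- indices from Fin n₁ are the vertices u_i of G₁; an index in
-- Fin (n₁ * n₂) is decoded by remQuot as (i , a) = vertex a of the
-- i-th copy of G₂.

copyOf : ∀ {n₁} n₂ → Fin (n₁ ℕ.* n₂) → Fin n₁
copyOf {n₁} n₂ p = proj₁ (remQuot {n₁} n₂ p)

vertOf : ∀ {n₁} n₂ → Fin (n₁ ℕ.* n₂) → Fin n₂
vertOf {n₁} n₂ p = proj₂ (remQuot {n₁} n₂ p)

coronaAdj : ∀ {n₁ n₂} → Graph n₁ → Graph n₂ →
            Fin (n₁ ℕ.+ n₁ ℕ.* n₂) → Fin (n₁ ℕ.+ n₁ ℕ.* n₂) → Bool
coronaAdj {n₁} {n₂} G₁ G₂ x y with splitAt n₁ x | splitAt n₁ y
... | inj₁ i | inj₁ j = Adj G₁ i j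
... | inj₁ i | inj₂ q = ⌊ i ≟ᶠ copyOf {n₁} n₂ q ⌋
... | inj₂ p | inj₁ j = ⌊ copyOf {n₁} n₂ p ≟ᶠ j ⌋
... | inj₂ p | inj₂ q =
  ⌊ copyOf {n₁} n₂ p ≟ᶠ copyOf {n₁} n₂ q ⌋
  ∧ Adj G₂ (vertOf {n₁} n₂ p) (vertOf {n₁} n₂ q)

-- Ordered commutative rings in which every nonnegative element has a
-- nonnegative square root (e.g. the real numbers ℝ).

record SqrtOrderedRing (c ℓ : Level) : Set (lsuc (c ⊔ ℓ)) where
  field
    commutativeRing : CommutativeRing c ℓ
  open CommutativeRing commutativeRing public
  infix 4 _≤_ _<_
  field
    _≤_          : Rel Carrier ℓ
    isTotalOrder : IsTotalOrder _≈_ _≤_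
  _<_ : Rel Carrier ℓ
  x < y = x ≤ y Data.Product.× ¬ (x ≈ y)
  field
    +-monoʳ-≤    : ∀ {x y} z → x ≤ y → x + z ≤ y + z
    *-nonneg     : ∀ {x y} → 0# ≤ x → 0# ≤ y → 0# ≤ x * y
    *-pos        : ∀ {x y} → 0# < x → 0# < y → 0# < x * y
    √            : Carrier → Carrier
    √-nonneg     : ∀ x → 0# ≤ √ x
    √-square     : ∀ {x} → 0# ≤ x → √ x * √ x ≈ x

  ι : ℕ → Carrier
  ι zero    = 0#
  ι (suc n) = 1# + ι n

module _ {c ℓ} (R : SqrtOrderedRing c ℓ) where
  open SqrtOrderedRing R

  sumFin : ∀ {n} → (Fin n → Carrier) → Carrier
  sumFin {n} f = foldr _+_ 0# (map f (allFin n))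

  ESOA : ∀ {n} → (Fin n → Fin n → Bool) → Carrier
  ESOA A = sumFin (λ u → sumFin (λ v →
    if A u v ∧ (toℕ u ℕ.<ᵇ toℕ v)
    then (ι (degA A u) + ι (degA A v))
         * √ (ι (degA A u) * ι (degA A u) + ι (degA A v) * ι (degA A v))
    else 0#))

  ESO : ∀ {n} → Graph n → Carrier
  ESO G = ESOA (Adj G)

  ESO-corona : ∀ {n₁ n₂} → Graph n₁ → Graph n₂ → Carrier
  ESO-corona G₁ G₂ = ESOA (coronaAdj G₁ G₂)

  αbound : ∀ {n₁ n₂} → Graph n₁ → Graph n₂ → ℕ → ℕ → Carrier
  αbound {n₁} {n₂} G₁ G₂ D₁ D₂ =
      ι 2 * √ (ι 2) * ι (edgeCount G₁) * (ι (D₁ ℕ.+ n₂) * ι (D₁ ℕ.+ n₂))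
    + ι 2 * √ (ι 2) * ι n₁ * ι (edgeCount G₂) * (ι (D₂ ℕ.+ 1) * ι (D₂ ℕ.+ 1))
    + ι n₁ * ι n₂ * ι (D₁ ℕ.+ n₂ ℕ.+ D₂ ℕ.+ 1)
      * √ (ι (D₁ ℕ.+ n₂) * ι (D₁ ℕ.+ n₂) + ι (D₂ ℕ.+ 1) * ι (D₂ ℕ.+ 1))

  α₁ : ∀ {n₁ n₂} → Graph n₁ → Graph n₂ → Carrier
  α₁ G₁ G₂ = αbound G₁ G₂ (minDeg G₁) (minDeg G₂)

  α₂ : ∀ {n₁ n₂} → Graph n₁ → Graph n₂ → Carrier
  α₂ G₁ G₂ = αbound G₁ G₂ (maxDeg G₁) (maxDeg G₂)

-- In G₁ ∘ G₂ a vertex u of G₁ has degree d_{G₁}(u) + n₂ and a vertex a of a copy of G₂ has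
-- degree d_{G₂}(a) + 1.  Splitting the edges into those of G₁, those inside the n₁ copies and the
-- n₁ n₂ spokes joining u_i to its copy, ESO(G₁ ∘ G₂) is the ESO-sum of G₁ with all degrees shifted
-- by n₂, plus n₁ times that of G₂ with degrees shifted by 1, plus the spoke terms.  The edge weight
-- (x + y) √(x² + y²) is monotone in both degrees, so replacing every degree by the minimum
-- (maximum) degree of its graph bounds each part from below (above); on the diagonal the weight
-- is 2√2 x², which produces the coefficients of α₁ and α₂.
module Submission where

open import Defs
open import Algebra.Bundles using (CommutativeMonoid)
open import Data.Bool using (Bool; true; false; if_then_else_; _∧_)
open import Data.Bool.Properties using (∧-zeroʳ)
open import Data.Fin using (Fin; zero; suc; toℕ; _↑ˡ_; _↑ʳ_; combine)
open import Data.Fin.Properties using (splitAt-↑ˡ; splitAt-↑ʳ; remQuot-combine; toℕ-↑ˡ; _≟_)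
open import Data.List using (foldr; map; allFin; tabulate)
open import Data.Nat as ℕ using (ℕ; _<ᵇ_; _⊓_; _⊔_)
import Data.Nat.Properties as ℕ
open import Data.Product using (_×_; _,_; proj₁; proj₂)
import Data.Vec.Functional as Vector
open import Data.Sum using (inj₁; inj₂)
open import Function using (_∘_)
open import Relation.Binary.Bundles using (Poset)
open import Relation.Binary.Structures using (IsTotalOrder)
open import Relation.Nullary.Decidable using (⌊_⌋; ⌊⌋-map′)
import Relation.Binary.PropositionalEquality as ≡
open ≡ using (_≡_)

foldr-map-tabulate : ∀ {a b c} {A : Set a} {B : Set b} {C : Set c} (f : B → C → C) (z : C)
                     {n} (g : A → B) (h : Fin n → A) →
                     foldr f z (map g (tabulate h)) ≡ Vector.foldr f z (g ∘ h)
foldr-map-tabulate f z {ℕ.zero}  g h = ≡.refl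
foldr-map-tabulate f z {ℕ.suc n} g h = ≡.cong (f (g (h zero))) (foldr-map-tabulate f z g (h ∘ suc))

foldr-map-allFin : ∀ {a b} {A : Set a} {B : Set b} (f : A → B → B) (z : B) {n} (g : Fin n → A) →
                   foldr f z (map g (allFin n)) ≡ Vector.foldr f z g
foldr-map-allFin f z g = foldr-map-tabulate f z g (λ i → i)

module FinSum {a ℓ} (M : CommutativeMonoid a ℓ) where
  open CommutativeMonoid M renaming (_∙_ to _+_; ε to 0#)
  open import Algebra.Properties.CommutativeMonoid.Sum M public

  sum-zero : ∀ {n} {f : Fin n → Carrier} → (∀ i → f i ≈ 0#) → sum f ≈ 0#
  sum-zero {n} f≈0 = trans (sum-cong-≋ f≈0) (sum-replicate-zero n)

  sum-↑ : ∀ m {n} (f : Fin (m ℕ.+ n) → Carrier) →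
          sum f ≈ sum (λ i → f (i ↑ˡ n)) + sum (λ j → f (m ↑ʳ j))
  sum-↑ ℕ.zero    f = sym (identityˡ _)
  sum-↑ (ℕ.suc m) f = trans (∙-congˡ (sum-↑ m (f ∘ suc))) (sym (assoc _ _ _))

  sum-combine : ∀ m {n} (f : Fin (m ℕ.* n) → Carrier) →
                sum f ≈ ∑[ i < m ] ∑[ j < n ] f (combine i j)
  sum-combine ℕ.zero        f = refl
  sum-combine (ℕ.suc m) {n} f = trans (sum-↑ n f) (∙-congˡ (sum-combine m (λ q → f (n ↑ʳ q))))

  sum-corona : ∀ m {n} (f : Fin (m ℕ.+ m ℕ.* n) → Carrier) →
               sum f ≈ ∑[ i < m ] f (i ↑ˡ m ℕ.* n) + ∑[ k < m ] ∑[ a < n ] f (m ↑ʳ combine k a)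
  sum-corona m f = trans (sum-↑ m f) (∙-congˡ (sum-combine m (λ q → f (m ↑ʳ q))))

  sum-select : ∀ {n} (k : Fin n) (f : Bool → Fin n → Carrier) → (∀ l → f false l ≈ 0#) →
               ∑[ l < n ] f ⌊ k ≟ l ⌋ l ≈ f true k
  sum-select zero    f f≈0 = trans (∙-congˡ (sum-zero (f≈0 ∘ suc))) (identityʳ _)
  sum-select {ℕ.suc n} (suc k) f f≈0 =
    trans (∙-congʳ (f≈0 zero)) (trans (identityˡ _) (trans (reflexive (sum-cong-≗ ⌊suc≟suc⌋))
      (sum-select k (λ b → f b ∘ suc) (f≈0 ∘ suc))))
    where
    ⌊suc≟suc⌋ : ∀ l → f ⌊ suc k ≟ suc l ⌋ (suc l) ≡ f ⌊ k ≟ l ⌋ (suc l)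
    ⌊suc≟suc⌋ l = ≡.cong (λ b → f b (suc l)) (⌊⌋-map′ _ _ (k ≟ l))

module ℕ∑ = FinSum ℕ.+-0-commutativeMonoid
open ℕ∑ using () renaming (sum to ∑ℕ)

∑ℕ-1 : ∀ n → ∑ℕ {n} (λ _ → 1) ≡ n
∑ℕ-1 ℕ.zero    = ≡.refl
∑ℕ-1 (ℕ.suc n) = ≡.cong ℕ.suc (∑ℕ-1 n)

degA≡∑ : ∀ {n} (A : Fin n → Fin n → Bool) u → degA A u ≡ ∑ℕ (λ v → b2n (A u v))
degA≡∑ A u = foldr-map-allFin ℕ._+_ 0 (λ v → b2n (A u v))

edgeCount≡∑ : ∀ {n} (G : Graph n) →
              edgeCount G ≡ ∑ℕ (λ u → ∑ℕ (λ v → b2n (Adj G u v ∧ (toℕ u <ᵇ toℕ v))))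
edgeCount≡∑ {n} G = ≡.trans (foldr-map-allFin ℕ._+_ 0 (λ u → sumFinℕ (edge u)))
                             (ℕ∑.sum-cong-≗ {n} λ u → foldr-map-allFin ℕ._+_ 0 (edge u))
  where
  edge : Fin n → Fin n → ℕ
  edge u v = b2n (Adj G u v ∧ (toℕ u <ᵇ toℕ v))

foldr-⊓-≤ : ∀ {n} z (f : Fin n → ℕ) i → Vector.foldr _⊓_ z f ℕ.≤ f i
foldr-⊓-≤ z f zero    = ℕ.m⊓n≤m _ _
foldr-⊓-≤ z f (suc i) = ℕ.≤-trans (ℕ.m⊓n≤n (f zero) _) (foldr-⊓-≤ z (f ∘ suc) i)

≤-foldr-⊔ : ∀ {n} z (f : Fin n → ℕ) i → f i ℕ.≤ Vector.foldr _⊔_ z f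
≤-foldr-⊔ z f zero    = ℕ.m≤m⊔n _ _
≤-foldr-⊔ z f (suc i) = ℕ.≤-trans (≤-foldr-⊔ z (f ∘ suc) i) (ℕ.m≤n⊔m (f zero) _)

minDeg≤deg : ∀ {n} (G : Graph n) i → minDeg G ℕ.≤ deg G i
minDeg≤deg {n} G i =
  ≡.subst (ℕ._≤ deg G i) (≡.sym (foldr-map-allFin _⊓_ n (deg G))) (foldr-⊓-≤ n (deg G) i)

deg≤maxDeg : ∀ {n} (G : Graph n) i → deg G i ℕ.≤ maxDeg G
deg≤maxDeg G i =
  ≡.subst (deg G i ℕ.≤_) (≡.sym (foldr-map-allFin _⊔_ 0 (deg G))) (≤-foldr-⊔ 0 (deg G) i)

↑ˡ-<ᵇ-↑ʳ : ∀ {m n} (i : Fin m) (j : Fin n) → (toℕ (i ↑ˡ n) <ᵇ toℕ (m ↑ʳ j)) ≡ true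
↑ˡ-<ᵇ-↑ʳ zero    j = ≡.refl
↑ˡ-<ᵇ-↑ʳ (suc i) j = ↑ˡ-<ᵇ-↑ʳ i j

↑ʳ-<ᵇ-↑ˡ : ∀ {m n} (j : Fin n) (i : Fin m) → (toℕ (m ↑ʳ j) <ᵇ toℕ (i ↑ˡ n)) ≡ false
↑ʳ-<ᵇ-↑ˡ j zero    = ≡.refl
↑ʳ-<ᵇ-↑ˡ j (suc i) = ↑ʳ-<ᵇ-↑ˡ j i

↑ˡ-<ᵇ-↑ˡ : ∀ {m} n (i j : Fin m) → (toℕ (i ↑ˡ n) <ᵇ toℕ (j ↑ˡ n)) ≡ (toℕ i <ᵇ toℕ j)
↑ˡ-<ᵇ-↑ˡ n i j = ≡.cong₂ _<ᵇ_ (toℕ-↑ˡ i n) (toℕ-↑ˡ j n)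

↑ʳ-<ᵇ-↑ʳ : ∀ m {n} (i j : Fin n) → (toℕ (m ↑ʳ i) <ᵇ toℕ (m ↑ʳ j)) ≡ (toℕ i <ᵇ toℕ j)
↑ʳ-<ᵇ-↑ʳ ℕ.zero    i j = ≡.refl
↑ʳ-<ᵇ-↑ʳ (ℕ.suc m) i j = ↑ʳ-<ᵇ-↑ʳ m i j

combine-<ᵇ-combine : ∀ {m n} (k : Fin m) (a b : Fin n) →
                     (toℕ (combine k a) <ᵇ toℕ (combine k b)) ≡ (toℕ a <ᵇ toℕ b)
combine-<ᵇ-combine {ℕ.suc m} {n} zero    a b = ↑ˡ-<ᵇ-↑ˡ (m ℕ.* n) a b
combine-<ᵇ-combine {ℕ.suc m} {n} (suc k) a b = ≡.trans (↑ʳ-<ᵇ-↑ʳ n _ _) (combine-<ᵇ-combine k a b)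

module Corona {n₁ n₂} (G₁ : Graph n₁) (G₂ : Graph n₂) where
  open ≡.≡-Reasoning
  open ℕ∑ using (sum-cong-≗; sum-corona; sum-select; sum-zero)

  A : Fin (n₁ ℕ.+ n₁ ℕ.* n₂) → Fin (n₁ ℕ.+ n₁ ℕ.* n₂) → Bool
  A = coronaAdj G₁ G₂

  base : Fin n₁ → Fin (n₁ ℕ.+ n₁ ℕ.* n₂)
  base i = i ↑ˡ n₁ ℕ.* n₂

  copy : Fin n₁ → Fin n₂ → Fin (n₁ ℕ.+ n₁ ℕ.* n₂)
  copy k a = n₁ ↑ʳ combine k a

  A-base-base : ∀ i j → A (base i) (base j) ≡ Adj G₁ i j
  A-base-base i j rewrite splitAt-↑ˡ n₁ i (n₁ ℕ.* n₂) | splitAt-↑ˡ n₁ j (n₁ ℕ.* n₂) = ≡.refl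

  A-base-copy : ∀ i k a → A (base i) (copy k a) ≡ ⌊ i ≟ k ⌋
  A-base-copy i k a rewrite splitAt-↑ˡ n₁ i (n₁ ℕ.* n₂) | splitAt-↑ʳ n₁ (n₁ ℕ.* n₂) (combine k a) =
    ≡.cong (λ p → ⌊ i ≟ proj₁ p ⌋) (remQuot-combine k a)

  A-copy-base : ∀ k a j → A (copy k a) (base j) ≡ ⌊ k ≟ j ⌋
  A-copy-base k a j rewrite splitAt-↑ʳ n₁ (n₁ ℕ.* n₂) (combine k a) | splitAt-↑ˡ n₁ j (n₁ ℕ.* n₂) =
    ≡.cong (λ p → ⌊ proj₁ p ≟ j ⌋) (remQuot-combine k a)

  A-copy-copy : ∀ k a l b → A (copy k a) (copy l b) ≡ ⌊ k ≟ l ⌋ ∧ Adj G₂ a b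
  A-copy-copy k a l b
    rewrite splitAt-↑ʳ n₁ (n₁ ℕ.* n₂) (combine k a) | splitAt-↑ʳ n₁ (n₁ ℕ.* n₂) (combine l b) =
    ≡.cong₂ (λ p q → ⌊ proj₁ p ≟ proj₁ q ⌋ ∧ Adj G₂ (proj₂ p) (proj₂ q))
            (remQuot-combine k a) (remQuot-combine l b)

  copy-<ᵇ-copy : ∀ k a b → (toℕ (copy k a) <ᵇ toℕ (copy k b)) ≡ (toℕ a <ᵇ toℕ b)
  copy-<ᵇ-copy k a b = ≡.trans (↑ʳ-<ᵇ-↑ʳ n₁ (combine k a) (combine k b)) (combine-<ᵇ-combine k a b)

  deg-base : ∀ i → degA A (base i) ≡ deg G₁ i ℕ.+ n₂
  deg-base i = begin
    degA A (base i)
      ≡⟨ ≡.trans (degA≡∑ A (base i)) (sum-corona n₁ _) ⟩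
    ∑ℕ (λ j → b2n (A (base i) (base j))) ℕ.+ ∑ℕ (λ k → ∑ℕ (λ a → b2n (A (base i) (copy k a))))
      ≡⟨ ≡.cong₂ ℕ._+_ (sum-cong-≗ (≡.cong b2n ∘ A-base-base i))
                       (sum-cong-≗ λ k → sum-cong-≗ λ a → ≡.cong b2n (A-base-copy i k a)) ⟩
    ∑ℕ (λ j → b2n (Adj G₁ i j)) ℕ.+ ∑ℕ (λ k → ∑ℕ {n₂} (λ _ → b2n ⌊ i ≟ k ⌋))
      ≡⟨ ≡.cong₂ ℕ._+_ (≡.sym (degA≡∑ (Adj G₁) i))
                       (sum-select i (λ c _ → ∑ℕ {n₂} (λ _ → b2n c))
                                     (λ _ → sum-zero {n₂} (λ _ → ≡.refl))) ⟩
    deg G₁ i ℕ.+ ∑ℕ {n₂} (λ _ → 1)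
      ≡⟨ ≡.cong (deg G₁ i ℕ.+_) (∑ℕ-1 n₂) ⟩
    deg G₁ i ℕ.+ n₂ ∎

  deg-copy : ∀ k a → degA A (copy k a) ≡ deg G₂ a ℕ.+ 1
  deg-copy k a = begin
    degA A (copy k a)
      ≡⟨ ≡.trans (degA≡∑ A (copy k a)) (sum-corona n₁ _) ⟩
    ∑ℕ (λ j → b2n (A (copy k a) (base j))) ℕ.+ ∑ℕ (λ l → ∑ℕ (λ b → b2n (A (copy k a) (copy l b))))
      ≡⟨ ≡.cong₂ ℕ._+_ (sum-cong-≗ (≡.cong b2n ∘ A-copy-base k a))
                       (sum-cong-≗ λ l → sum-cong-≗ λ b → ≡.cong b2n (A-copy-copy k a l b)) ⟩
    ∑ℕ (λ j → b2n ⌊ k ≟ j ⌋) ℕ.+ ∑ℕ (λ l → ∑ℕ (λ b → b2n (⌊ k ≟ l ⌋ ∧ Adj G₂ a b)))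
      ≡⟨ ≡.cong₂ ℕ._+_ (sum-select k (λ c _ → b2n c) (λ _ → ≡.refl))
                       (sum-select k (λ c _ → ∑ℕ {n₂} (λ b → b2n (c ∧ Adj G₂ a b)))
                                     (λ _ → sum-zero {n₂} (λ _ → ≡.refl))) ⟩
    1 ℕ.+ ∑ℕ (λ b → b2n (Adj G₂ a b))
      ≡⟨ ≡.trans (ℕ.+-comm 1 _) (≡.cong (ℕ._+ 1) (≡.sym (degA≡∑ (Adj G₂) a))) ⟩
    deg G₂ a ℕ.+ 1 ∎

module SqrtOrderedRingProperties {c ℓ} (R : SqrtOrderedRing c ℓ) where
  open SqrtOrderedRing R hiding (zero)
  open import Algebra.Properties.Ring ring using (-1*x≈-x; -‿involutive; x[y-z]≈xy-xz)
  open FinSum +-commutativeMonoid using (sum)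

  poset : Poset c ℓ ℓ
  poset = record { isPartialOrder = IsTotalOrder.isPartialOrder isTotalOrder }

  open Poset poset public using ()
    renaming (trans to ≤-trans; reflexive to ≤-reflexive; antisym to ≤-antisym)
  open import Relation.Binary.Reasoning.PartialOrder poset

  +-mono-≤ : ∀ {x y u v} → x ≤ y → u ≤ v → x + u ≤ y + v
  +-mono-≤ {x} {y} {u} {v} x≤y u≤v = begin
    x + u  ≤⟨ +-monoʳ-≤ u x≤y ⟩
    y + u  ≈⟨ +-comm y u ⟩
    u + y  ≤⟨ +-monoʳ-≤ y u≤v ⟩
    v + y  ≈⟨ +-comm v y ⟩
    y + v  ∎

  +-nonneg : ∀ {x y} → 0# ≤ x → 0# ≤ y → 0# ≤ x + y
  +-nonneg {x} {y} 0≤x 0≤y = begin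
    0#      ≈⟨ +-identityʳ 0# ⟨
    0# + 0# ≤⟨ +-mono-≤ 0≤x 0≤y ⟩
    x + y   ∎

  x-y+y≈x : ∀ x y → x - y + y ≈ x
  x-y+y≈x x y = trans (+-assoc x (- y) y) (trans (+-congˡ (-‿inverseˡ y)) (+-identityʳ x))

  x≤y⇒0≤y-x : ∀ {x y} → x ≤ y → 0# ≤ y - x
  x≤y⇒0≤y-x {x} {y} x≤y = begin
    0#     ≈⟨ -‿inverseʳ x ⟨
    x - x  ≤⟨ +-monoʳ-≤ (- x) x≤y ⟩
    y - x  ∎

  *-monoˡ-≤ : ∀ {z x y} → 0# ≤ z → x ≤ y → z * x ≤ z * y
  *-monoˡ-≤ {z} {x} {y} 0≤z x≤y = begin
    z * x                ≈⟨ +-identityˡ (z * x) ⟨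
    0# + z * x           ≤⟨ +-monoʳ-≤ (z * x) (*-nonneg 0≤z (x≤y⇒0≤y-x x≤y)) ⟩
    z * (y - x) + z * x  ≈⟨ distribˡ z (y - x) x ⟨
    z * (y - x + x)      ≈⟨ *-congˡ (x-y+y≈x y x) ⟩
    z * y                ∎

  *-monoʳ-≤ : ∀ {z x y} → 0# ≤ z → x ≤ y → x * z ≤ y * z
  *-monoʳ-≤ {z} {x} {y} 0≤z x≤y = begin
    x * z  ≈⟨ *-comm x z ⟩
    z * x  ≤⟨ *-monoˡ-≤ 0≤z x≤y ⟩
    z * y  ≈⟨ *-comm z y ⟩
    y * z  ∎

  *-mono-≤ : ∀ {x y u v} → 0# ≤ x → 0# ≤ u → x ≤ y → u ≤ v → x * u ≤ y * v
  *-mono-≤ 0≤x 0≤u x≤y u≤v = ≤-trans (*-monoˡ-≤ 0≤x u≤v) (*-monoʳ-≤ (≤-trans 0≤u u≤v) x≤y)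

  0≤1 : 0# ≤ 1#
  0≤1 with IsTotalOrder.total isTotalOrder 0# 1#
  ... | inj₁ 0≤1 = 0≤1
  ... | inj₂ 1≤0 = begin
    0#              ≤⟨ *-nonneg 0≤-1 0≤-1 ⟩
    - 1# * - 1#     ≈⟨ -1*x≈-x (- 1#) ⟩
    - (- 1#)        ≈⟨ -‿involutive 1# ⟩
    1#              ∎
    where
    0≤-1 : 0# ≤ - 1#
    0≤-1 = ≤-trans (x≤y⇒0≤y-x 1≤0) (≤-reflexive (+-identityˡ (- 1#)))

  ι-nonneg : ∀ n → 0# ≤ ι n
  ι-nonneg ℕ.zero    = ≤-reflexive refl
  ι-nonneg (ℕ.suc n) = +-nonneg 0≤1 (ι-nonneg n)

  ι-mono : ∀ {m n} → m ℕ.≤ n → ι m ≤ ι n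
  ι-mono {n = n} ℕ.z≤n = ι-nonneg n
  ι-mono (ℕ.s≤s m≤n)   = +-mono-≤ (≤-reflexive refl) (ι-mono m≤n)

  ι-+ : ∀ m n → ι (m ℕ.+ n) ≈ ι m + ι n
  ι-+ ℕ.zero    n = sym (+-identityˡ (ι n))
  ι-+ (ℕ.suc m) n = trans (+-congˡ (ι-+ m n)) (sym (+-assoc 1# (ι m) (ι n)))

  ι-* : ∀ m n → ι (m ℕ.* n) ≈ ι m * ι n
  ι-* ℕ.zero    n = sym (zeroˡ (ι n))
  ι-* (ℕ.suc m) n = begin-equality
    ι (n ℕ.+ m ℕ.* n)      ≈⟨ ι-+ n (m ℕ.* n) ⟩
    ι n + ι (m ℕ.* n)      ≈⟨ +-cong (sym (*-identityˡ (ι n))) (ι-* m n) ⟩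
    1# * ι n + ι m * ι n   ≈⟨ distribʳ (ι n) 1# (ι m) ⟨
    (1# + ι m) * ι n       ∎

  ι1≈1 : ι 1 ≈ 1#
  ι1≈1 = +-identityʳ 1#

  ι*ι-mono : ∀ {a b} → a ℕ.≤ b → ι a * ι a ≤ ι b * ι b
  ι*ι-mono {a} a≤b = *-mono-≤ (ι-nonneg a) (ι-nonneg a) (ι-mono a≤b) (ι-mono a≤b)

  1≤ι*ι+ι*ι : ∀ a b → 1 ℕ.≤ a ℕ.* a ℕ.+ b ℕ.* b → 1# ≤ ι a * ι a + ι b * ι b
  1≤ι*ι+ι*ι a b 1≤a²+b² = begin
    1#                         ≈⟨ ι1≈1 ⟨
    ι 1                        ≤⟨ ι-mono 1≤a²+b² ⟩
    ι (a ℕ.* a ℕ.+ b ℕ.* b)    ≈⟨ ι-+ (a ℕ.* a) (b ℕ.* b) ⟩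
    ι (a ℕ.* a) + ι (b ℕ.* b)  ≈⟨ +-cong (ι-* a a) (ι-* b b) ⟩
    ι a * ι a + ι b * ι b      ∎

  ι2*x≈x+x : ∀ x → ι 2 * x ≈ x + x
  ι2*x≈x+x x = trans (distribʳ x 1# (ι 1))
                     (+-cong (*-identityˡ x) (trans (*-congʳ ι1≈1) (*-identityˡ x)))

  1≤x*x⇒1≤x : ∀ {x} → 0# ≤ x → 1# ≤ x * x → 1# ≤ x
  1≤x*x⇒1≤x {x} 0≤x 1≤x*x with IsTotalOrder.total isTotalOrder x 1#
  ... | inj₂ 1≤x = 1≤x
  ... | inj₁ x≤1 = begin
    1#      ≤⟨ 1≤x*x ⟩
    x * x   ≤⟨ *-monoˡ-≤ 0≤x x≤1 ⟩
    x * 1#  ≈⟨ *-identityʳ x ⟩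
    x       ∎

  -- Without decidable ≈ the axiom *-pos cannot refute x > y; instead,
  -- 1 ≤ x turns x (x - y) ≤ 0 into x - y ≤ 0.
  x*x≤y*y⇒x≤y : ∀ {x y} → 0# ≤ x → 0# ≤ y → 1# ≤ x * x → x * x ≤ y * y → x ≤ y
  x*x≤y*y⇒x≤y {x} {y} 0≤x 0≤y 1≤x*x x*x≤y*y with IsTotalOrder.total isTotalOrder x y
  ... | inj₁ x≤y = x≤y
  ... | inj₂ y≤x = begin
    x            ≈⟨ x-y+y≈x x y ⟨
    x - y + y    ≤⟨ +-monoʳ-≤ y x-y≤0 ⟩
    0# + y       ≈⟨ +-identityˡ y ⟩
    y            ∎
    where
    x-y≤0 : x - y ≤ 0#
    x-y≤0 = begin
      x - y          ≈⟨ *-identityˡ (x - y) ⟨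
      1# * (x - y)   ≤⟨ *-monoʳ-≤ (x≤y⇒0≤y-x y≤x) (1≤x*x⇒1≤x 0≤x 1≤x*x) ⟩
      x * (x - y)    ≈⟨ x[y-z]≈xy-xz x x y ⟩
      x * x - x * y  ≤⟨ +-monoʳ-≤ (- (x * y)) (≤-trans x*x≤y*y (*-monoʳ-≤ 0≤y y≤x)) ⟩
      x * y - x * y  ≈⟨ -‿inverseʳ (x * y) ⟩
      0#             ∎

  √-mono-≤ : ∀ {x y} → 1# ≤ x → x ≤ y → √ x ≤ √ y
  √-mono-≤ {x} {y} 1≤x x≤y = x*x≤y*y⇒x≤y (√-nonneg x) (√-nonneg y)
    (≤-trans 1≤x (≤-reflexive (sym (√-square 0≤x))))
    (begin
      √ x * √ x  ≈⟨ √-square 0≤x ⟩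
      x          ≤⟨ x≤y ⟩
      y          ≈⟨ √-square (≤-trans 0≤x x≤y) ⟨
      √ y * √ y  ∎)
    where
    0≤x : 0# ≤ x
    0≤x = ≤-trans 0≤1 1≤x

  √-unique : ∀ {x v} → 1# ≤ x → 0# ≤ v → v * v ≈ x → √ x ≈ v
  √-unique {x} {v} 1≤x 0≤v v*v≈x = ≤-antisym
    (x*x≤y*y⇒x≤y (√-nonneg x) 0≤v (≤-trans 1≤x (≤-reflexive (sym √x*√x≈x)))
                 (≤-reflexive (trans √x*√x≈x (sym v*v≈x))))
    (x*x≤y*y⇒x≤y 0≤v (√-nonneg x) (≤-trans 1≤x (≤-reflexive (sym v*v≈x)))
                 (≤-reflexive (trans v*v≈x (sym √x*√x≈x))))
    where
    √x*√x≈x : √ x * √ x ≈ x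
    √x*√x≈x = √-square (≤-trans 0≤1 1≤x)

  ι*-≤-sum : ∀ {n K} {f : Fin n → Carrier} → (∀ i → K ≤ f i) → ι n * K ≤ sum f
  ι*-≤-sum {ℕ.zero}  {K} _   = ≤-reflexive (zeroˡ K)
  ι*-≤-sum {ℕ.suc n} {K} {f} K≤f = begin
    (1# + ι n) * K     ≈⟨ distribʳ K 1# (ι n) ⟩
    1# * K + ι n * K   ≈⟨ +-congʳ (*-identityˡ K) ⟩
    K + ι n * K        ≤⟨ +-mono-≤ (K≤f zero) (ι*-≤-sum (K≤f ∘ suc)) ⟩
    sum f              ∎

  sum-≤-ι* : ∀ {n K} {f : Fin n → Carrier} → (∀ i → f i ≤ K) → sum f ≤ ι n * K
  sum-≤-ι* {ℕ.zero}  {K} _   = ≤-reflexive (sym (zeroˡ K))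
  sum-≤-ι* {ℕ.suc n} {K} {f} f≤K = begin
    sum f              ≤⟨ +-mono-≤ (f≤K zero) (sum-≤-ι* (f≤K ∘ suc)) ⟩
    K + ι n * K        ≈⟨ +-congʳ (*-identityˡ K) ⟨
    1# * K + ι n * K   ≈⟨ distribʳ K 1# (ι n) ⟨
    (1# + ι n) * K     ∎

  ι∑*-≤-sum : ∀ {n K} (c : Fin n → ℕ) {f : Fin n → Carrier} →
              (∀ i → ι (c i) * K ≤ f i) → ι (∑ℕ c) * K ≤ sum f
  ι∑*-≤-sum {ℕ.zero}  {K} _ _     = ≤-reflexive (zeroˡ K)
  ι∑*-≤-sum {ℕ.suc n} {K} c {f} cK≤f = begin
    ι (c zero ℕ.+ ∑ℕ (c ∘ suc)) * K             ≈⟨ *-congʳ (ι-+ (c zero) _) ⟩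
    (ι (c zero) + ι (∑ℕ (c ∘ suc))) * K         ≈⟨ distribʳ K _ _ ⟩
    ι (c zero) * K + ι (∑ℕ (c ∘ suc)) * K       ≤⟨ +-mono-≤ (cK≤f zero) (ι∑*-≤-sum (c ∘ suc) (cK≤f ∘ suc)) ⟩
    sum f                                       ∎

  sum-≤-ι∑* : ∀ {n K} (c : Fin n → ℕ) {f : Fin n → Carrier} →
              (∀ i → f i ≤ ι (c i) * K) → sum f ≤ ι (∑ℕ c) * K
  sum-≤-ι∑* {ℕ.zero}  {K} _ _     = ≤-reflexive (sym (zeroˡ K))
  sum-≤-ι∑* {ℕ.suc n} {K} c {f} f≤cK = begin
    sum f                                       ≤⟨ +-mono-≤ (f≤cK zero) (sum-≤-ι∑* (c ∘ suc) (f≤cK ∘ suc)) ⟩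
    ι (c zero) * K + ι (∑ℕ (c ∘ suc)) * K       ≈⟨ distribʳ K _ _ ⟨
    (ι (c zero) + ι (∑ℕ (c ∘ suc))) * K         ≈⟨ *-congʳ (ι-+ (c zero) _) ⟨
    ι (c zero ℕ.+ ∑ℕ (c ∘ suc)) * K             ∎

  ι[b2n]*-≤-if : ∀ e {K W} → K ≤ W → ι (b2n e) * K ≤ (if e then W else 0#)
  ι[b2n]*-≤-if true  {K} {W} K≤W = begin
    ι 1 * K  ≈⟨ *-congʳ ι1≈1 ⟩
    1# * K   ≈⟨ *-identityˡ K ⟩
    K        ≤⟨ K≤W ⟩
    W        ∎
  ι[b2n]*-≤-if false {K} _ = ≤-reflexive (zeroˡ K)

  if-≤-ι[b2n]* : ∀ e {K W} → W ≤ K → (if e then W else 0#) ≤ ι (b2n e) * K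
  if-≤-ι[b2n]* true  {K} {W} W≤K = begin
    W        ≤⟨ W≤K ⟩
    K        ≈⟨ *-identityˡ K ⟨
    1# * K   ≈⟨ *-congʳ ι1≈1 ⟨
    ι 1 * K  ∎
  if-≤-ι[b2n]* false {K} _ = ≤-reflexive (sym (zeroˡ K))

module EllipticSombor {c ℓ} (R : SqrtOrderedRing c ℓ) where
  open SqrtOrderedRing R hiding (zero)
  open SqrtOrderedRingProperties R
  open FinSum +-commutativeMonoid using (sum; sum-syntax; sum-cong-≗)
  open import Relation.Binary.Reasoning.PartialOrder poset
  open import Algebra.Solver.Ring.NaturalCoefficients.Default commutativeSemiring
    using (solve; _:=_; _:+_; _:*_)

  weight : ℕ → ℕ → Carrier
  weight a b = (ι a + ι b) * √ (ι a * ι a + ι b * ι b)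

  edgeTerm : Bool → ℕ → ℕ → Carrier
  edgeTerm e a b = if e then weight a b else 0#

  ESOA≡∑ : ∀ {n} (A : Fin n → Fin n → Bool) →
           ESOA R A ≡ ∑[ u < n ] ∑[ v < n ] edgeTerm (A u v ∧ (toℕ u <ᵇ toℕ v)) (degA A u) (degA A v)
  ESOA≡∑ {n} A = ≡.trans (foldr-map-allFin _+_ 0# (λ u → sumFin R (term u)))
                         (sum-cong-≗ {n} λ u → foldr-map-allFin _+_ 0# (term u))
    where
    term : Fin n → Fin n → Carrier
    term u v = edgeTerm (A u v ∧ (toℕ u <ᵇ toℕ v)) (degA A u) (degA A v)

  weight-nonneg : ∀ a b → 0# ≤ weight a b
  weight-nonneg a b = *-nonneg (+-nonneg (ι-nonneg a) (ι-nonneg b)) (√-nonneg _)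

  weight-zero : weight 0 0 ≈ 0#
  weight-zero = trans (*-congʳ (+-identityʳ 0#)) (zeroˡ _)

  -- √ is only known to be monotone from 1 on, hence the separate case a = b = 0 below.
  weight-mono-≤-from-1 : ∀ {a b a′ b′} → 1 ℕ.≤ a ℕ.* a ℕ.+ b ℕ.* b →
                         a ℕ.≤ a′ → b ℕ.≤ b′ → weight a b ≤ weight a′ b′
  weight-mono-≤-from-1 {a} {b} 1≤a²+b² a≤a′ b≤b′ =
    *-mono-≤ (+-nonneg (ι-nonneg a) (ι-nonneg b)) (√-nonneg _)
      (+-mono-≤ (ι-mono a≤a′) (ι-mono b≤b′))
      (√-mono-≤ (1≤ι*ι+ι*ι a b 1≤a²+b²) (+-mono-≤ (ι*ι-mono a≤a′) (ι*ι-mono b≤b′)))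

  weight-mono-≤ : ∀ {a b a′ b′} → a ℕ.≤ a′ → b ℕ.≤ b′ → weight a b ≤ weight a′ b′
  weight-mono-≤ {ℕ.zero}  {ℕ.zero} {a′} {b′} _ _ = begin
    weight 0 0    ≈⟨ weight-zero ⟩
    0#            ≤⟨ weight-nonneg a′ b′ ⟩
    weight a′ b′  ∎
  weight-mono-≤ {ℕ.suc a} {b}       = weight-mono-≤-from-1 (ℕ.s≤s ℕ.z≤n)
  weight-mono-≤ {ℕ.zero}  {ℕ.suc b} = weight-mono-≤-from-1 (ℕ.s≤s ℕ.z≤n)

  weight-diag : ∀ a → weight a a ≈ ι 2 * √ (ι 2) * (ι a * ι a)
  weight-diag ℕ.zero = begin-equality
    weight 0 0                   ≈⟨ weight-zero ⟩
    0#                           ≈⟨ zeroʳ _ ⟨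
    ι 2 * √ (ι 2) * 0#           ≈⟨ *-congˡ (zeroˡ 0#) ⟨
    ι 2 * √ (ι 2) * (0# * 0#)    ∎
  weight-diag a@(ℕ.suc _) = begin-equality
    (x + x) * √ (x * x + x * x)  ≈⟨ *-congˡ (√-unique (1≤ι*ι+ι*ι a a (ℕ.s≤s ℕ.z≤n))
                                                       (*-nonneg (√-nonneg _) (ι-nonneg a)) rx*rx) ⟩
    (x + x) * (r * x)            ≈⟨ solve 2 (λ x r → (x :+ x) :* (r :* x) := (r :+ r) :* (x :* x)) refl x r ⟩
    (r + r) * (x * x)            ≈⟨ *-congʳ (ι2*x≈x+x r) ⟨
    ι 2 * r * (x * x)            ∎
    where
    x r : Carrier
    x = ι a
    r = √ (ι 2)
    rx*rx : (r * x) * (r * x) ≈ x * x + x * x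
    rx*rx = begin-equality
      (r * x) * (r * x)  ≈⟨ solve 2 (λ r x → (r :* x) :* (r :* x) := (r :* r) :* (x :* x)) refl r x ⟩
      (r * r) * (x * x)  ≈⟨ *-congʳ (√-square (ι-nonneg 2)) ⟩
      ι 2 * (x * x)      ≈⟨ ι2*x≈x+x (x * x) ⟩
      x * x + x * x      ∎

  shiftedESO : ∀ {n} → Graph n → ℕ → Carrier
  shiftedESO {n} G s =
    ∑[ u < n ] ∑[ v < n ] edgeTerm (Adj G u v ∧ (toℕ u <ᵇ toℕ v)) (deg G u ℕ.+ s) (deg G v ℕ.+ s)

  shiftedESO-≥ : ∀ {n} (G : Graph n) s →
                 ι (edgeCount G) * weight (minDeg G ℕ.+ s) (minDeg G ℕ.+ s) ≤ shiftedESO G s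
  shiftedESO-≥ G s = ≡.subst (λ m → ι m * K ≤ shiftedESO G s) (≡.sym (edgeCount≡∑ G))
    (ι∑*-≤-sum _ λ u → ι∑*-≤-sum _ λ v → ι[b2n]*-≤-if _ (weight-mono-≤ (δ+s≤ u) (δ+s≤ v)))
    where
    K : Carrier
    K = weight (minDeg G ℕ.+ s) (minDeg G ℕ.+ s)
    δ+s≤ : ∀ u → minDeg G ℕ.+ s ℕ.≤ deg G u ℕ.+ s
    δ+s≤ u = ℕ.+-monoˡ-≤ s (minDeg≤deg G u)

  shiftedESO-≤ : ∀ {n} (G : Graph n) s →
                 shiftedESO G s ≤ ι (edgeCount G) * weight (maxDeg G ℕ.+ s) (maxDeg G ℕ.+ s)
  shiftedESO-≤ G s = ≡.subst (λ m → shiftedESO G s ≤ ι m * K) (≡.sym (edgeCount≡∑ G))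
    (sum-≤-ι∑* _ λ u → sum-≤-ι∑* _ λ v → if-≤-ι[b2n]* _ (weight-mono-≤ (≤Δ+s u) (≤Δ+s v)))
    where
    K : Carrier
    K = weight (maxDeg G ℕ.+ s) (maxDeg G ℕ.+ s)
    ≤Δ+s : ∀ u → deg G u ℕ.+ s ℕ.≤ maxDeg G ℕ.+ s
    ≤Δ+s u = ℕ.+-monoˡ-≤ s (deg≤maxDeg G u)

module CoronaESO {c ℓ} (R : SqrtOrderedRing c ℓ) {n₁ n₂} (G₁ : Graph n₁) (G₂ : Graph n₂) where
  open SqrtOrderedRing R hiding (zero)
  open SqrtOrderedRingProperties R
  open EllipticSombor R
  open Corona G₁ G₂
  open FinSum +-commutativeMonoid
    using (sum; sum-syntax; sum-cong-≗; sum-cong-≋; sum-corona; sum-select; sum-zero; ∑-distrib-+)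
  open import Algebra.Properties.CommutativeSemigroup +-commutativeSemigroup using (xy∙z≈xz∙y)
  open import Relation.Binary.Reasoning.PartialOrder poset
  open import Algebra.Solver.Ring.NaturalCoefficients.Default commutativeSemiring
    using (solve; _:=_; _:+_; _:*_)

  d₁ : Fin n₁ → ℕ
  d₁ i = deg G₁ i ℕ.+ n₂

  d₂ : Fin n₂ → ℕ
  d₂ a = deg G₂ a ℕ.+ 1

  term : Fin (n₁ ℕ.+ n₁ ℕ.* n₂) → Fin (n₁ ℕ.+ n₁ ℕ.* n₂) → Carrier
  term x y = edgeTerm (A x y ∧ (toℕ x <ᵇ toℕ y)) (degA A x) (degA A y)

  term-cong : ∀ {x y e o p q} → A x y ≡ e → (toℕ x <ᵇ toℕ y) ≡ o → degA A x ≡ p → degA A y ≡ q →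
              term x y ≡ edgeTerm (e ∧ o) p q
  term-cong ≡.refl ≡.refl ≡.refl ≡.refl = ≡.refl

  term-base-base : ∀ i j → term (base i) (base j) ≡ edgeTerm (Adj G₁ i j ∧ (toℕ i <ᵇ toℕ j)) (d₁ i) (d₁ j)
  term-base-base i j = term-cong (A-base-base i j) (↑ˡ-<ᵇ-↑ˡ (n₁ ℕ.* n₂) i j) (deg-base i) (deg-base j)

  -- The redundant `∧ true` lets `edgeTerm (false ∧ true)` reduce to 0# inside `sum-select`.
  term-base-copy : ∀ i k a → term (base i) (copy k a) ≡ edgeTerm (⌊ i ≟ k ⌋ ∧ true) (d₁ i) (d₂ a)
  term-base-copy i k a = term-cong (A-base-copy i k a) (↑ˡ-<ᵇ-↑ʳ i (combine k a)) (deg-base i) (deg-copy k a)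

  term-copy-base : ∀ k a j → term (copy k a) (base j) ≡ 0#
  term-copy-base k a j = ≡.cong (λ e → edgeTerm e (degA A (copy k a)) (degA A (base j)))
    (≡.trans (≡.cong (A (copy k a) (base j) ∧_) (↑ʳ-<ᵇ-↑ˡ (combine k a) j)) (∧-zeroʳ _))

  term-copy-copy : ∀ k a l b → term (copy k a) (copy l b) ≡
    edgeTerm ((⌊ k ≟ l ⌋ ∧ Adj G₂ a b) ∧ (toℕ (copy k a) <ᵇ toℕ (copy l b))) (d₂ a) (d₂ b)
  term-copy-copy k a l b = term-cong (A-copy-copy k a l b) ≡.refl (deg-copy k a) (deg-copy l b)

  row-base : ∀ i → sum (term (base i)) ≈
    ∑[ j < n₁ ] edgeTerm (Adj G₁ i j ∧ (toℕ i <ᵇ toℕ j)) (d₁ i) (d₁ j) + ∑[ a < n₂ ] weight (d₁ i) (d₂ a)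
  row-base i = trans (sum-corona n₁ (term (base i)))
    (+-cong (reflexive (sum-cong-≗ (term-base-base i)))
            (trans (reflexive (sum-cong-≗ λ k → sum-cong-≗ (term-base-copy i k)))
                   (sum-select i (λ e _ → ∑[ a < n₂ ] edgeTerm (e ∧ true) (d₁ i) (d₂ a))
                                 (λ _ → sum-zero {n₂} (λ _ → refl)))))

  row-copy : ∀ k a → sum (term (copy k a)) ≈ ∑[ b < n₂ ] edgeTerm (Adj G₂ a b ∧ (toℕ a <ᵇ toℕ b)) (d₂ a) (d₂ b)
  row-copy k a = begin-equality
    sum (term (copy k a))
      ≈⟨ sum-corona n₁ (term (copy k a)) ⟩
    ∑[ j < n₁ ] term (copy k a) (base j) + ∑[ l < n₁ ] ∑[ b < n₂ ] term (copy k a) (copy l b)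
      ≈⟨ +-cong (sum-zero (λ j → reflexive (term-copy-base k a j)))
                (reflexive (sum-cong-≗ λ l → sum-cong-≗ (term-copy-copy k a l))) ⟩
    0# + ∑[ l < n₁ ] toCopy ⌊ k ≟ l ⌋ l
      ≈⟨ +-identityˡ _ ⟩
    ∑[ l < n₁ ] toCopy ⌊ k ≟ l ⌋ l
      ≈⟨ sum-select k toCopy (λ _ → sum-zero {n₂} (λ _ → refl)) ⟩
    ∑[ b < n₂ ] edgeTerm (Adj G₂ a b ∧ (toℕ (copy k a) <ᵇ toℕ (copy k b))) (d₂ a) (d₂ b)
      ≡⟨ sum-cong-≗ (λ b → ≡.cong (λ o → edgeTerm (Adj G₂ a b ∧ o) (d₂ a) (d₂ b)) (copy-<ᵇ-copy k a b)) ⟩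
    ∑[ b < n₂ ] edgeTerm (Adj G₂ a b ∧ (toℕ a <ᵇ toℕ b)) (d₂ a) (d₂ b) ∎
    where
    toCopy : Bool → Fin n₁ → Carrier
    toCopy e l = ∑[ b < n₂ ] edgeTerm ((e ∧ Adj G₂ a b) ∧ (toℕ (copy k a) <ᵇ toℕ (copy l b))) (d₂ a) (d₂ b)

  spokeSum : Carrier
  spokeSum = ∑[ i < n₁ ] ∑[ a < n₂ ] weight (d₁ i) (d₂ a)

  ESO-corona≈ : ESO-corona R G₁ G₂ ≈ shiftedESO G₁ n₂ + ∑[ k < n₁ ] shiftedESO G₂ 1 + spokeSum
  ESO-corona≈ = begin-equality
    ESO-corona R G₁ G₂
      ≡⟨ ESOA≡∑ A ⟩
    ∑[ x < n₁ ℕ.+ n₁ ℕ.* n₂ ] sum (term x)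
      ≈⟨ sum-corona n₁ (sum ∘ term) ⟩
    ∑[ i < n₁ ] sum (term (base i)) + ∑[ k < n₁ ] ∑[ a < n₂ ] sum (term (copy k a))
      ≈⟨ +-cong (sum-cong-≋ row-base) (sum-cong-≋ λ k → sum-cong-≋ (row-copy k)) ⟩
    ∑[ i < n₁ ] (∑[ j < n₁ ] edgeTerm (Adj G₁ i j ∧ (toℕ i <ᵇ toℕ j)) (d₁ i) (d₁ j)
                 + ∑[ a < n₂ ] weight (d₁ i) (d₂ a))
      + ∑[ k < n₁ ] shiftedESO G₂ 1
      ≈⟨ +-congʳ (∑-distrib-+ {n₁} _ _) ⟩
    shiftedESO G₁ n₂ + spokeSum + ∑[ k < n₁ ] shiftedESO G₂ 1
      ≈⟨ xy∙z≈xz∙y _ _ _ ⟩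
    shiftedESO G₁ n₂ + ∑[ k < n₁ ] shiftedESO G₂ 1 + spokeSum ∎

  αbound≈ : ∀ D₁ D₂ → αbound R G₁ G₂ D₁ D₂ ≈
      ι (edgeCount G₁) * weight (D₁ ℕ.+ n₂) (D₁ ℕ.+ n₂)
    + ι n₁ * (ι (edgeCount G₂) * weight (D₂ ℕ.+ 1) (D₂ ℕ.+ 1))
    + ι n₁ * (ι n₂ * weight (D₁ ℕ.+ n₂) (D₂ ℕ.+ 1))
  αbound≈ D₁ D₂ = begin-equality
    t * r * m₁ * (x * x) + t * r * n * m₂ * (y * y) + n * k * ι (D₁ ℕ.+ n₂ ℕ.+ D₂ ℕ.+ 1) * s
      ≈⟨ +-congˡ (*-congʳ (*-congˡ ι[X+Y]≈x+y)) ⟩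
    t * r * m₁ * (x * x) + t * r * n * m₂ * (y * y) + n * k * (x + y) * s
      ≈⟨ solve 9 (λ t r m₁ x n m₂ y k s →
           t :* r :* m₁ :* (x :* x) :+ t :* r :* n :* m₂ :* (y :* y) :+ n :* k :* (x :+ y) :* s
           := m₁ :* (t :* r :* (x :* x)) :+ n :* (m₂ :* (t :* r :* (y :* y))) :+ n :* (k :* ((x :+ y) :* s)))
           refl t r m₁ x n m₂ y k s ⟩
    m₁ * (t * r * (x * x)) + n * (m₂ * (t * r * (y * y))) + n * (k * ((x + y) * s))
      ≈⟨ +-congʳ (+-cong (*-congˡ (weight-diag X)) (*-congˡ (*-congˡ (weight-diag Y)))) ⟨
    m₁ * weight X X + n * (m₂ * weight Y Y) + n * (k * weight X Y) ∎
    where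
    X Y : ℕ
    X = D₁ ℕ.+ n₂
    Y = D₂ ℕ.+ 1
    t r x y s n k m₁ m₂ : Carrier
    t = ι 2
    r = √ (ι 2)
    x = ι X
    y = ι Y
    s = √ (x * x + y * y)
    n = ι n₁
    k = ι n₂
    m₁ = ι (edgeCount G₁)
    m₂ = ι (edgeCount G₂)
    ι[X+Y]≈x+y : ι (X ℕ.+ D₂ ℕ.+ 1) ≈ x + y
    ι[X+Y]≈x+y = trans (reflexive (≡.cong ι (ℕ.+-assoc X D₂ 1))) (ι-+ X Y)

  α₁≤ESO-corona : α₁ R G₁ G₂ ≤ ESO-corona R G₁ G₂
  α₁≤ESO-corona = begin
    α₁ R G₁ G₂
      ≈⟨ αbound≈ δ₁ δ₂ ⟩
    ι (edgeCount G₁) * weight X X + ι n₁ * (ι (edgeCount G₂) * weight Y Y) + ι n₁ * (ι n₂ * weight X Y)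
      ≤⟨ +-mono-≤ (+-mono-≤ (shiftedESO-≥ G₁ n₂) (ι*-≤-sum {n₁} λ _ → shiftedESO-≥ G₂ 1))
                  (ι*-≤-sum {n₁} λ i → ι*-≤-sum {n₂} λ a → weight-mono-≤ (X≤d₁ i) (Y≤d₂ a)) ⟩
    shiftedESO G₁ n₂ + ∑[ k < n₁ ] shiftedESO G₂ 1 + spokeSum
      ≈⟨ ESO-corona≈ ⟨
    ESO-corona R G₁ G₂ ∎
    where
    δ₁ δ₂ X Y : ℕ
    δ₁ = minDeg G₁
    δ₂ = minDeg G₂
    X = δ₁ ℕ.+ n₂
    Y = δ₂ ℕ.+ 1
    X≤d₁ : ∀ i → X ℕ.≤ d₁ i
    X≤d₁ i = ℕ.+-monoˡ-≤ n₂ (minDeg≤deg G₁ i)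
    Y≤d₂ : ∀ a → Y ℕ.≤ d₂ a
    Y≤d₂ a = ℕ.+-monoˡ-≤ 1 (minDeg≤deg G₂ a)

  ESO-corona≤α₂ : ESO-corona R G₁ G₂ ≤ α₂ R G₁ G₂
  ESO-corona≤α₂ = begin
    ESO-corona R G₁ G₂
      ≈⟨ ESO-corona≈ ⟩
    shiftedESO G₁ n₂ + ∑[ k < n₁ ] shiftedESO G₂ 1 + spokeSum
      ≤⟨ +-mono-≤ (+-mono-≤ (shiftedESO-≤ G₁ n₂) (sum-≤-ι* {n₁} λ _ → shiftedESO-≤ G₂ 1))
                  (sum-≤-ι* {n₁} λ i → sum-≤-ι* {n₂} λ a → weight-mono-≤ (d₁≤X i) (d₂≤Y a)) ⟩
    ι (edgeCount G₁) * weight X X + ι n₁ * (ι (edgeCount G₂) * weight Y Y) + ι n₁ * (ι n₂ * weight X Y)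
      ≈⟨ αbound≈ Δ₁ Δ₂ ⟨
    α₂ R G₁ G₂ ∎
    where
    Δ₁ Δ₂ X Y : ℕ
    Δ₁ = maxDeg G₁
    Δ₂ = maxDeg G₂
    X = Δ₁ ℕ.+ n₂
    Y = Δ₂ ℕ.+ 1
    d₁≤X : ∀ i → d₁ i ℕ.≤ X
    d₁≤X i = ℕ.+-monoˡ-≤ n₂ (deg≤maxDeg G₁ i)
    d₂≤Y : ∀ a → d₂ a ℕ.≤ Y
    d₂≤Y a = ℕ.+-monoˡ-≤ 1 (deg≤maxDeg G₂ a)

theorem3 : ∀ {c ℓ} (R : SqrtOrderedRing c ℓ) {n₁ n₂ : ℕ}
           (G₁ : Graph n₁) (G₂ : Graph n₂) →
           SqrtOrderedRing._≤_ R (α₁ R G₁ G₂) (ESO-corona R G₁ G₂)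
           × SqrtOrderedRing._≤_ R (ESO-corona R G₁ G₂) (α₂ R G₁ G₂)
theorem3 R G₁ G₂ = α₁≤ESO-corona , ESO-corona≤α₂
  where open CoronaESO R G₁ G₂
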